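{- Under axioms C2, C3, C4, SV1, SV2, RW2, RW3, RW5, RW6, RW7 and MP, the following proof outline of the Write-to-Read-Causality program is valid (every thread is locally correct and the outline is globally correct). Precondition: $[x=0]_1\cap[x=0]_2\cap[y=0]_3\cap r_1=0\cap r_2=0$. Thread 1: $\{[x=0]_1\cap[x\not\approx 1]_2\cap r_1\neq 1\}\ x:=1\ \{true\}$. Thread 2: $\{[y\not\approx 1]_3\cap r_2\neq 1\cap([x=0]_2\cup\langle x=1\rangle[x=1]_2)\}\ r_1:=x\ \{[y\not\approx 1]_3\cap r_2\neq 1\cap(r_1\neq 1\cup[x=1]_2)\}\ y:=^{\sf WS}1\ \{true\}$. Thread 3: $\{r_1\neq 1\cup\langle y=1\rangle^{\sf S}[x=1]_3\}\ r_2:=^{\sf RS}y\ \{r_1\neq 1\cup r_2\neq 1\cup[x=1]_3\}\ r_3:=x\ \{r_1\neq 1\cup r_2\neq 1\cup r_3=1\}$. Postcondition: $r_1\neq 1\cup r_2\neq 1\cup r_3=1$.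
   Context: Setting: programs are parallel compositions of threads over global variables ($x,y$) and thread-local registers ($r_1,r_2,r_3$), all initially 0; semantics is a transition system $(\mathsf{Act_{ext}},\Sigma,I,T)$ of an arbitrary memory model, actions $rd(x,r,v)$, $rd^{\sf RS}(x,r,v)$, $wr(x,v)$, $wr^{\sf WS}(x,v)$, $fence$. $\operatorname{\mathsf{wlp}}(R,P)=\{\sigma\mid\forall\sigma'.(\sigma,\sigma')\in R\Rightarrow\sigma'\in P\}$, $\operatorname{\mathsf{dis}}(R)=\operatorname{\mathsf{wlp}}(R,\emptyset)$, $R;R'$ relational composition, $\mathrm{dom}(R)$ domain. The memory model provides $\mathit{vmax}(t,a)$ and $\mathit{interf}(t,a)$; $\beta$ is the weakest $R$ with $R;T(t,a)\subseteq T(t,a);R$ and $\mathit{vmax}(t,a)\subseteq\operatorname{\mathsf{wlp}}(R,\mathit{vmax}(t,a))$. Assertions: $[x\not\approx v]_t=\operatorname{\mathsf{dis}}(T(t,\mathit{Rd}_{|x}[v]))$; $[x\equiv v]_t=\bigcap_{u\neq v}[x\not\approx u]_t$; $x_{\uparrow t}=\bigcap_{a\in\mathsf{Act}_{|x}}\mathit{vmax}(t,a)$; $[x=v]_t=[x\equiv v]_t\cap x_{\uparrow t}$; $\langle x=v\rangle[x=v]_t=\operatorname{\mathsf{wlp}}(T(t,rd(x,\cdot,v)),[x=v]_t)$; $\langle y=u\rangle^{\sf S}[x=v]_t=\operatorname{\mathsf{wlp}}(T(t,rd^{\sf RS}(y,\cdot,u)),[x=v]_t)$. $\{P\}\ com_t\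 \{Q\}$ means $P\subseteq\operatorname{\mathsf{wlp}}(T(t,a),Q)$ for every action $a$ of $com$ in thread $t$. Local correctness: $\{P\}\ com_t\ \{Q\}$ for each command with its pre/post-assertions; global correctness: $\{R\cap P\}\ com_{t'}\ \{R\}$ for every assertion $R$ of thread $t$ and command $com$ of another thread $t'$ with pre-assertion $P$. Axioms: C2: if $\sigma\in\mathit{vmax}(t,a)$, $(\sigma,\sigma')\in T(t,a)$, there is $\tau$ with $(\sigma',\tau)\in\beta$, $(\sigma,\tau)\in T(t',a);\beta$. C3: $T(t,a)\subseteq\beta;\mathit{interf}(t,a);\beta$. C4: $\mathit{vmax}(t,a)\subseteq\operatorname{\mathsf{wlp}}(\mathit{interf}(t,b),\mathit{vmax}(t,a))$. SV1: $\mathit{var}(a)\neq\mathit{var}(b)\Rightarrow\mathit{interf}(t',b);T(t,a)\subseteq T(t,a);\mathit{interf}(t',b)$. SV2: $\mathit{var}(a)\neq\mathit{var}(b)\Rightarrow\mathit{vmax}(t,a)\subseteq\operatorname{\mathsf{wlp}}(\mathit{interf}(t',b),\mathit{vmax}(t,a))$. RW2: $a_r\in\mathit{Rd}_{|\mathit{var}(a)}\Rightarrow\mathit{interf}(t',a_r);T(t,a)\subseteq T(t,a);\mathit{interf}(t',a_r)$. RW3: $a_r\in\mathit{Rd}_{|\mathit{var}(a)}\Rightarrow\mathit{vmax}(t,a)\subseteq\operatorname{\mathsf{wlp}}(\mathit{interf}(t',a_r),\mathit{vmax}(t,a))$. RW5: for $a_w\in Wr_{|x}$, $v=\mathit{wrval}(a_w)$: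 $\Sigma\subseteq\operatorname{\mathsf{wlp}}(T(t,a_w),\mathrm{dom}(T(t,\mathit{Rd}_{|x}[v])))$. RW6: $x_{\uparrow t}\subseteq\bigcup_v[x\equiv v]_t$. RW7: for $a_w,a_r,a\in\mathsf{Act}_{|x}$, $\mathit{wrval}(a_w)=\mathit{rdval}(a_r)$, $t\neq t'$: $\mathit{vmax}(t,a_w)\cap\operatorname{\mathsf{dis}}(T(t',a_r))\subseteq\operatorname{\mathsf{wlp}}(T(t,a_w),\operatorname{\mathsf{wlp}}(T(t',a_r),\mathit{vmax}(t',a)))$. MP: for synchronizing $a_w$ (WS) and $a_r$ (RS) on the same variable with $\mathit{wrval}(a_w)=\mathit{rdval}(a_r)$, $\mathit{var}(b)\neq\mathit{var}(a_w)$, $t\neq t'$: $\mathit{vmax}(t,b)\cap\operatorname{\mathsf{wlp}}(T(t',a_r),\mathit{vmax}(t',b))\subseteq\operatorname{\mathsf{wlp}}(T(t,a_w),\operatorname{\mathsf{wlp}}(T(t',a_r),\mathit{vmax}(t',b)))$. -}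

module Defs where

open import Level using (Level; _⊔_; 0ℓ) renaming (suc to lsuc)
open import Data.Nat using (ℕ)
open import Data.Bool using (Bool; true; false; if_then_else_)
open import Data.Product using (Σ; ∃; _×_; _,_; ∃-syntax; proj₁; proj₂)
open import Data.Sum using (_⊎_)
open import Data.Empty using (⊥)
open import Data.Maybe using (Maybe; just; nothing)
open import Data.List using (List; []; _∷_)
open import Data.List.Relation.Unary.All using (All)
open import Relation.Unary using (Pred; _⊆_; _∩_; _∪_; U)
open import Relation.Binary.PropositionalEquality using (_≡_; _≢_)

Val : Set
Val = ℕ

Thread : Set
Thread = ℕ

data Var : Set where
  x y : Var

data Reg : Set where
  r₁ r₂ r₃ : Reg

data Act : Set where
  rd rdRS : Var → Reg → Val → Act
  wr wrWS : Var → Val → Act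
  fence   : Act

var : Act → Maybe Var
var (rd z _ _)   = just z
var (rdRS z _ _) = just z
var (wr z _)     = just z
var (wrWS z _)   = just z
var fence        = nothing

OnVar : Var → Act → Set
OnVar z a = var a ≡ just z

data IsRd (z : Var) (v : Val) : Act → Set where
  is-rd   : ∀ r → IsRd z v (rd z r v)
  is-rdRS : ∀ r → IsRd z v (rdRS z r v)

data IsWr (z : Var) (v : Val) : Act → Set where
  is-wr   : IsWr z v (wr z v)
  is-wrWS : IsWr z v (wrWS z v)

HRel : ∀ {a} → Set a → (ℓ : Level) → Set (a ⊔ lsuc ℓ)
HRel A ℓ = A → A → Set ℓ

_⨾_ : ∀ {a ℓ₁ ℓ₂} {A : Set a} → HRel A ℓ₁ → HRel A ℓ₂ → HRel A (a ⊔ ℓ₁ ⊔ ℓ₂)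
(R ⨾ S) σ τ = ∃[ ρ ] (R σ ρ × S ρ τ)
infixr 9 _⨾_

_⊆₂_ : ∀ {a ℓ₁ ℓ₂} {A : Set a} → HRel A ℓ₁ → HRel A ℓ₂ → Set (a ⊔ ℓ₁ ⊔ ℓ₂)
R ⊆₂ S = ∀ {σ τ} → R σ τ → S σ τ

wlp : ∀ {a ℓ₁ ℓ₂} {A : Set a} → HRel A ℓ₁ → Pred A ℓ₂ → Pred A (a ⊔ ℓ₁ ⊔ ℓ₂)
wlp R P σ = ∀ σ' → R σ σ' → P σ'

dis : ∀ {a ℓ} {A : Set a} → HRel A ℓ → Pred A (a ⊔ ℓ)
dis R = wlp R (λ _ → ⊥)

dom : ∀ {a ℓ} {A : Set a} → HRel A ℓ → Pred A (a ⊔ ℓ)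
dom R σ = ∃[ σ' ] R σ σ'

record MemoryModel : Set₁ where
  field
    Γ      : Set
    T      : Thread → Act → HRel Γ 0ℓ
    vmax   : Thread → Act → Pred Γ 0ℓ
    interf : Thread → Act → HRel Γ 0ℓ

module Model (M : MemoryModel) where
  open MemoryModel M public

  TS : Thread → Pred Act 0ℓ → HRel Γ 0ℓ
  TS t A σ σ' = ∃[ a ] (A a × T t a σ σ')

  βCond : HRel Γ 0ℓ → Set
  βCond R = (∀ t a → (R ⨾ T t a) ⊆₂ (T t a ⨾ R))
          × (∀ t a → vmax t a ⊆ wlp R (vmax t a))

  -- β: the weakest (largest) R satisfying βCond, i.e. the union of all of them
  β : HRel Γ (lsuc 0ℓ)
  β σ τ = ∃[ R ] (βCond R × R σ τ)

  NotRd : Thread → Var → Val → Pred Γ 0ℓ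
  NotRd t z v = dis (TS t (IsRd z v))

  Equiv : Thread → Var → Val → Pred Γ 0ℓ
  Equiv t z v γ = ∀ u → u ≢ v → NotRd t z u γ

  Up : Thread → Var → Pred Γ 0ℓ
  Up t z γ = ∀ a → OnVar z a → vmax t a γ

  Def : Thread → Var → Val → Pred Γ 0ℓ
  Def t z v = Equiv t z v ∩ Up t z

  Cond : Thread → Var → Val → Pred Γ 0ℓ → Pred Γ 0ℓ
  Cond t z v P = wlp (TS t (λ a → ∃[ r ] (a ≡ rd z r v))) P

  CondS : Thread → Var → Val → Pred Γ 0ℓ → Pred Γ 0ℓ
  CondS t z v P = wlp (TS t (λ a → ∃[ r ] (a ≡ rdRS z r v))) P

  record Axioms : Set₁ where
    field
      C2  : ∀ t t' a σ σ' → vmax t a σ → T t a σ σ' →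
            ∃[ τ ] (β σ' τ × (T t' a ⨾ β) σ τ)
      C3  : ∀ t a → T t a ⊆₂ (β ⨾ interf t a ⨾ β)
      C4  : ∀ t a b → vmax t a ⊆ wlp (interf t b) (vmax t a)
      SV1 : ∀ t t' a b z w → OnVar z a → OnVar w b → z ≢ w →
            (interf t' b ⨾ T t a) ⊆₂ (T t a ⨾ interf t' b)
      SV2 : ∀ t t' a b z w → OnVar z a → OnVar w b → z ≢ w →
            vmax t a ⊆ wlp (interf t' b) (vmax t a)
      RW2 : ∀ t t' a ar z v → OnVar z a → IsRd z v ar →
            (interf t' ar ⨾ T t a) ⊆₂ (T t a ⨾ interf t' ar)
      RW3 : ∀ t t' a ar z v → OnVar z a → IsRd z v ar →
            vmax t a ⊆ wlp (interf t' ar) (vmax t a)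
      RW5 : ∀ t z v aw → IsWr z v aw →
            U ⊆ wlp (T t aw) (dom (TS t (IsRd z v)))
      RW6 : ∀ t z → Up t z ⊆ (λ γ → ∃[ v ] Equiv t z v γ)
      RW7 : ∀ t t' z v aw ar a → IsWr z v aw → IsRd z v ar → OnVar z a → t ≢ t' →
            (vmax t aw ∩ dis (T t' ar)) ⊆ wlp (T t aw) (wlp (T t' ar) (vmax t' a))
      MP  : ∀ t t' z v r b w → OnVar w b → w ≢ z → t ≢ t' →
            (vmax t b ∩ wlp (T t' (rdRS z r v)) (vmax t' b))
              ⊆ wlp (T t (wrWS z v)) (wlp (T t' (rdRS z r v)) (vmax t' b))

  Regs : Set
  Regs = Reg → Val

  sameReg : Reg → Reg → Bool
  sameReg r₁ r₁ = true
  sameReg r₂ r₂ = true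
  sameReg r₃ r₃ = true
  sameReg _  _  = false

  upd : Regs → Reg → Val → Regs
  upd ρ r v r' = if sameReg r r' then v else ρ r'

  regEff : Act → Regs → Regs
  regEff (rd _ r v)   ρ = upd ρ r v
  regEff (rdRS _ r v) ρ = upd ρ r v
  regEff (wr _ _)     ρ = ρ
  regEff (wrWS _ _)   ρ = ρ
  regEff fence        ρ = ρ

  St : Set
  St = Regs × Γ

  TP : Thread → Act → HRel St 0ℓ
  TP t a (ρ , γ) (ρ' , γ') = T t a γ γ' × ρ' ≡ regEff a ρ

  ⌊_⌋ : Pred Γ 0ℓ → Pred St 0ℓ
  ⌊ P ⌋ s = P (proj₂ s)

  RegNe : Reg → Val → Pred St 0ℓ
  RegNe r v s = proj₁ s r ≢ v

  RegEq : Reg → Val → Pred St 0ℓ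
  RegEq r v s = proj₁ s r ≡ v

  record Cmd : Set₁ where
    constructor ⟪_⟫_⟪_⟫
    field
      pre  : Pred St 0ℓ
      acts : Pred Act 0ℓ
      post : Pred St 0ℓ
  open Cmd public

  Hoare : Thread → Pred St 0ℓ → Pred Act 0ℓ → Pred St 0ℓ → Set
  Hoare t P com Q = ∀ a → com a → P ⊆ wlp (TP t a) Q

  Outline : Set₁
  Outline = List (Thread × List Cmd)

  LocallyCorrect : Outline → Set₁
  LocallyCorrect O =
    All (λ tc → All (λ c → Hoare (proj₁ tc) (pre c) (acts c) (post c)) (proj₂ tc)) O

  GloballyCorrect : Outline → Set₁
  GloballyCorrect O =
    All (λ tc → All (λ tc' → proj₁ tc ≢ proj₁ tc' →
      All (λ c → All (λ R → All (λ c' →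
            Hoare (proj₁ tc') (R ∩ pre c') (acts c') R) (proj₂ tc'))
          (pre c ∷ post c ∷ [])) (proj₂ tc)) O) O

  x:=1 : Pred Act 0ℓ
  x:=1 a = a ≡ wr x 1

  r₁:=x : Pred Act 0ℓ
  r₁:=x a = ∃[ v ] (a ≡ rd x r₁ v)

  y:=ᵂˢ1 : Pred Act 0ℓ
  y:=ᵂˢ1 a = a ≡ wrWS y 1

  r₂:=ᴿˢy : Pred Act 0ℓ
  r₂:=ᴿˢy a = ∃[ v ] (a ≡ rdRS y r₂ v)

  r₃:=x : Pred Act 0ℓ
  r₃:=x a = ∃[ v ] (a ≡ rd x r₃ v)

  WRC-Pre : Pred St 0ℓ
  WRC-Pre = ⌊ Def 1 x 0 ⌋ ∩ ⌊ Def 2 x 0 ⌋ ∩ ⌊ Def 3 y 0 ⌋ ∩ RegEq r₁ 0 ∩ RegEq r₂ 0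

  WRC-Post : Pred St 0ℓ
  WRC-Post = RegNe r₁ 1 ∪ RegNe r₂ 1 ∪ RegEq r₃ 1

  A1-0 A1-1 : Pred St 0ℓ
  A1-0 = ⌊ Def 1 x 0 ⌋ ∩ ⌊ NotRd 2 x 1 ⌋ ∩ RegNe r₁ 1
  A1-1 = U

  A2-0 A2-1 A2-2 : Pred St 0ℓ
  A2-0 = ⌊ NotRd 3 y 1 ⌋ ∩ RegNe r₂ 1 ∩ (⌊ Def 2 x 0 ⌋ ∪ ⌊ Cond 2 x 1 (Def 2 x 1) ⌋)
  A2-1 = ⌊ NotRd 3 y 1 ⌋ ∩ RegNe r₂ 1 ∩ (RegNe r₁ 1 ∪ ⌊ Def 2 x 1 ⌋)
  A2-2 = U

  A3-0 A3-1 A3-2 : Pred St 0ℓ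
  A3-0 = RegNe r₁ 1 ∪ ⌊ CondS 3 y 1 (Def 3 x 1) ⌋
  A3-1 = RegNe r₁ 1 ∪ RegNe r₂ 1 ∪ ⌊ Def 3 x 1 ⌋
  A3-2 = RegNe r₁ 1 ∪ RegNe r₂ 1 ∪ RegEq r₃ 1

  WRC-Outline : Outline
  WRC-Outline =
      (1 , ⟪ A1-0 ⟫ x:=1 ⟪ A1-1 ⟫ ∷ [])
    ∷ (2 , ⟪ A2-0 ⟫ r₁:=x ⟪ A2-1 ⟫ ∷ ⟪ A2-1 ⟫ y:=ᵂˢ1 ⟪ A2-2 ⟫ ∷ [])
    ∷ (3 , ⟪ A3-0 ⟫ r₂:=ᴿˢy ⟪ A3-1 ⟫ ∷ ⟪ A3-1 ⟫ r₃:=x ⟪ A3-2 ⟫ ∷ [])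
    ∷ []

  ValidWRC : Set₁
  ValidWRC = (WRC-Pre ⊆ (A1-0 ∩ A2-0 ∩ A3-0))
           × ((A1-1 ∩ A2-2 ∩ A3-2) ⊆ WRC-Post)
           × LocallyCorrect WRC-Outline
           × GloballyCorrect WRC-Outline

-- The outline is built from stability facts. An interfering step of thread t' factors through
-- β ⨾ interf ⨾ β (C3), and β simulates every transition and preserves vmax, so an assertion
-- about variable z survives any action that reads z or touches another variable (SV1/SV2,
-- RW2/RW3). The two places where information flows between threads are
-- write-to-read causality (thread 2 reading 1 from thread 1's write obtains [x = 1]_2, by
-- RW5–RW7) and message passing (thread 3 reading y = 1 with RS obtains thread 2's [x = 1],
-- by MP); in both, C2 transfers the impossibility of reading other values of x to the
-- reading thread.
module Submission where

open import Defs
open import Level using (0ℓ) renaming (suc to lsuc)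
open import Data.Nat using (_≟_)
open import Data.Nat.Properties using (0≢1+n)
open import Data.Unit using (tt)
open import Data.Product using (_×_; _,_; ∃-syntax)
open import Data.Sum using (inj₁; inj₂; map₂)
open import Data.Empty using (⊥-elim)
open import Data.List.Relation.Unary.All using ([]; _∷_)
open import Relation.Unary using (Pred; _⊆_; _∩_; _∪_; U)
open import Relation.Nullary using (yes; no)
open import Relation.Binary.PropositionalEquality using (_≡_; _≢_; refl; sym; trans)

onRd : ∀ {z v a} → IsRd z v a → OnVar z a
onRd (is-rd r)   = refl
onRd (is-rdRS r) = refl

onWr : ∀ {z v a} → IsWr z v a → OnVar z a
onWr is-wr   = refl
onWr is-wrWS = refl

data Harmless (z : Var) (c : Act) : Set where
  elsewhere : ∀ {w} → OnVar w c → z ≢ w → Harmless z c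
  reads     : ∀ {u} → IsRd z u c → Harmless z c

module WRC (M : MemoryModel) (ax : Model.Axioms M) where
  open Model M
  open Axioms ax

  β-simulation : ∀ {t a σ ρ τ} → β σ ρ → T t a ρ τ → ∃[ τ' ] (T t a σ τ' × β τ' τ)
  β-simulation (R , cond@(simulates , _) , r) tr with simulates _ _ (_ , r , tr)
  ... | τ' , tr' , r' = τ' , tr' , (R , cond , r')

  β-vmax : ∀ {t a σ ρ} → vmax t a σ → β σ ρ → vmax t a ρ
  β-vmax m (R , (_ , keeps) , r) = keeps _ _ m _ r

  Interference : Thread → Act → HRel Γ (lsuc 0ℓ)
  Interference t c = β ⨾ interf t c ⨾ β

  Commutes : Thread → Act → Thread → Var → Set
  Commutes t' c t z = ∀ {b} → OnVar z b → (interf t' c ⨾ T t b) ⊆₂ (T t b ⨾ interf t' c)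

  KeepsVmax : Thread → Act → Thread → Var → Set
  KeepsVmax t' c t z = ∀ {a} → OnVar z a → vmax t a ⊆ wlp (interf t' c) (vmax t a)

  harmless-commutes : ∀ {t t' z c} → Harmless z c → Commutes t' c t z
  harmless-commutes {t} {t'} {z} {c} (elsewhere {w} oc z≢w) {b} ob = SV1 t t' b c z w ob oc z≢w
  harmless-commutes {t} {t'} {z} {c} (reads {u} ic) {b} ob = RW2 t t' b c z u ob ic

  harmless-keeps-vmax : ∀ {t t' z c} → Harmless z c → KeepsVmax t' c t z
  harmless-keeps-vmax {t} {t'} {z} {c} (elsewhere {w} oc z≢w) {a} oa = SV2 t t' a c z w oa oc z≢w
  harmless-keeps-vmax {t} {t'} {z} {c} (reads {u} ic) {a} oa = RW3 t t' a c z u oa ic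

  interference-commutes : ∀ {t t' c z b} → Commutes t' c t z → OnVar z b →
                          (Interference t' c ⨾ T t b) ⊆₂ (T t b ⨾ Interference t' c)
  interference-commutes cm ob (_ , (_ , b₁ , ρ₂ , i , b₂) , tr) with β-simulation b₂ tr
  ... | ρ₃ , tr₃ , b₃ with cm ob (ρ₂ , i , tr₃)
  ... | ρ₄ , tr₄ , i₄ with β-simulation b₁ tr₄
  ... | σ₀ , tr₀ , b₀ = σ₀ , tr₀ , (ρ₄ , b₀ , ρ₃ , i₄ , b₃)

  Stable : Thread → Act → Pred Γ 0ℓ → Set₁
  Stable t c P = ∀ {σ σ'} → P σ → Interference t c σ σ' → P σ'

  stable-step : ∀ {t c P σ σ'} → Stable t c P → P σ → T t c σ σ' → P σ'
  stable-step {t} {c} st p tr = st p (C3 t c tr)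

  ∪-stable : ∀ {t c P Q} → Stable t c P → Stable t c Q → Stable t c (P ∪ Q)
  ∪-stable stP stQ (inj₁ p) i = inj₁ (stP p i)
  ∪-stable stP stQ (inj₂ q) i = inj₂ (stQ q i)

  wlp-TS-stable : ∀ {t t' c z} {A : Pred Act 0ℓ} {P : Pred Γ 0ℓ} → Commutes t' c t z →
                  (∀ {a} → A a → OnVar z a) → Stable t' c P → Stable t' c (wlp (TS t A) P)
  wlp-TS-stable cm onz stP w i _ (a , aA , tr) with interference-commutes cm (onz aA) (_ , i , tr)
  ... | σ₀ , tr₀ , i₀ = stP (w σ₀ (a , aA , tr₀)) i₀

  NotRd-stable : ∀ {t t' c z u} → Commutes t' c t z → Stable t' c (NotRd t z u)
  NotRd-stable cm = wlp-TS-stable cm onRd (λ ())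

  Equiv-stable : ∀ {t t' c z v} → Commutes t' c t z → Stable t' c (Equiv t z v)
  Equiv-stable cm eq i u u≢v = NotRd-stable cm (eq u u≢v) i

  Up-stable : ∀ {t t' c z} → KeepsVmax t' c t z → Stable t' c (Up t z)
  Up-stable keeps up (_ , b₁ , ρ₂ , i , b₂) a oa = β-vmax (keeps oa (β-vmax (up a oa) b₁) ρ₂ i) b₂

  Def-stable : ∀ {t t' c z v} → Harmless z c → Stable t' c (Def t z v)
  Def-stable h (eq , up) i = Equiv-stable (harmless-commutes h) eq i , Up-stable (harmless-keeps-vmax h) up i

  Cond-stable : ∀ {t t' c z v P} → Harmless z c → Stable t' c P → Stable t' c (Cond t z v P)
  Cond-stable h = wlp-TS-stable (harmless-commutes h) λ { (_ , refl) → refl }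

  NotRd⇒CondS : ∀ {t z v P γ} → NotRd t z v γ → CondS t z v P γ
  NotRd⇒CondS n γ' (_ , (r , refl) , tr) = ⊥-elim (n γ' (_ , is-rdRS r , tr))

  NotRd-transfer : ∀ {t t' z u γ} → Up t z γ → NotRd t' z u γ → NotRd t z u γ
  NotRd-transfer {t} {t'} up n δ (b , ib , tr) with C2 t t' b _ δ (up b (onRd ib)) tr
  ... | _ , _ , ρ , tr' , _ = n ρ (b , ib , tr')

  Equiv-transfer : ∀ {t t' z v γ} → Up t z γ → Equiv t' z v γ → Equiv t z v γ
  Equiv-transfer up eq u u≢v = NotRd-transfer up (eq u u≢v)

  Equiv-readable : ∀ {t z v w γ} → Equiv t z w γ → dom (TS t (IsRd z v)) γ → v ≡ w
  Equiv-readable {v = v} {w} eq (δ , rd-v) with v ≟ w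
  ... | yes v≡w = v≡w
  ... | no  v≢w = ⊥-elim (eq v v≢w δ rd-v)

  -- RW6 says the writer's view of z is determined; RW5 says the written value is readable.
  Equiv-after-write : ∀ {t z v aw γ γ'} → Up t z γ → IsWr z v aw → T t aw γ γ' → Equiv t z v γ'
  Equiv-after-write {t} {z} {v} {aw} {γ} {γ'} up iw tw
    with RW6 t z (stable-step (Up-stable λ _ → C4 t _ aw) up tw)
  ... | w , eq with Equiv-readable eq (RW5 t z v aw iw {γ} tt γ' tw)
  ... | refl = eq

  read-from-write : ∀ {t t' z v aw ar γ γ' γ''} → t ≢ t' → IsWr z v aw → IsRd z v ar →
                    Up t z γ → NotRd t' z v γ → T t aw γ γ' → T t' ar γ' γ'' → Def t' z v γ''
  read-from-write {t} {t'} {z} {v} {aw} {ar} {γ' = γ'} {γ''} t≢t' iw ir up n tw tr =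
    Equiv-transfer up'' (stable-step (Equiv-stable (harmless-commutes (reads ir))) (Equiv-after-write up iw tw) tr) , up''
    where
      up'' : Up t' z γ''
      up'' a oa = RW7 t t' z v aw ar a iw ir oa t≢t'
                    (up aw (onWr iw) , λ δ tr' → n δ (ar , ir , tr')) γ' tw γ'' tr

  message-passing : ∀ {t t' z w u v r γ γ' γ''} → t ≢ t' → w ≢ z → Def t w v γ → NotRd t' z u γ →
                    T t (wrWS z u) γ γ' → T t' (rdRS z r u) γ' γ'' → Def t' w v γ''
  message-passing {t} {t'} {z} {w} {u} {r = r} {γ' = γ'} {γ''} t≢t' w≢z (eq , up) n tw tr =
    Equiv-transfer up'' (stable-step (flag-Equiv refl) (stable-step (flag-Equiv refl) eq tw) tr) , up''
    where
      flag-Equiv : ∀ {t₀ c v₀} → OnVar z c → Stable t₀ c (Equiv t w v₀)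
      flag-Equiv oc = Equiv-stable (harmless-commutes (elsewhere oc w≢z))

      up'' : Up t' w γ''
      up'' b ob = MP t t' z u r b w ob w≢z t≢t'
                    (up b ob , λ δ tr' → ⊥-elim (n δ (_ , is-rdRS r , tr'))) γ' tw γ'' tr

  hoare-U : ∀ {t P com} → Hoare t P com U
  hoare-U _ _ _ _ _ = tt

  Untouched : Reg → Pred Act 0ℓ → Set
  Untouched r com = ∀ a → com a → ∀ ρ → regEff a ρ r ≡ ρ r

  register-frame : ∀ {t r v P R com} → Untouched r com → P ⊆ RegNe r v → RegNe r v ⊆ R →
                   Hoare t (R ∩ P) com R
  register-frame keep P⇒ ⇒R a ca {ρ , _} (_ , p) _ (_ , refl) =
    ⇒R (λ e → P⇒ p (trans (sym (keep a ca ρ)) e))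

  r₁:=x-correct : Hoare 2 A2-0 r₁:=x A2-1
  r₁:=x-correct _ (v , refl) {ρ , γ} (n , r2 , d) (_ , γ') (tr , refl) =
    stable-step (NotRd-stable (harmless-commutes (elsewhere refl λ ()))) n tr , r2 , outcome d
    where
      outcome : (⌊ Def 2 x 0 ⌋ ∪ ⌊ Cond 2 x 1 (Def 2 x 1) ⌋) (ρ , γ) → (RegNe r₁ 1 ∪ ⌊ Def 2 x 1 ⌋) (upd ρ r₁ v , γ')
      outcome d with v ≟ 1
      outcome (inj₁ (eq , _)) | yes refl = ⊥-elim (eq 1 (λ ()) γ' (_ , is-rd r₁ , tr))
      outcome (inj₂ c)        | yes refl = inj₂ (c γ' (_ , (r₁ , refl) , tr))
      outcome d               | no v≢1   = inj₁ v≢1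

  r₂:=ᴿˢy-correct : Hoare 3 A3-0 r₂:=ᴿˢy A3-1
  r₂:=ᴿˢy-correct _ (_ , refl) (inj₁ r1) _ (_ , refl) = inj₁ r1
  r₂:=ᴿˢy-correct _ (v , refl) (inj₂ c) (_ , γ') (tr , refl) with v ≟ 1
  ... | yes refl = inj₂ (inj₂ (c γ' (_ , (r₂ , refl) , tr)))
  ... | no v≢1   = inj₂ (inj₁ v≢1)

  r₃:=x-correct : Hoare 3 A3-1 r₃:=x A3-2
  r₃:=x-correct _ (_ , refl) (inj₁ r1) _ (_ , refl) = inj₁ r1
  r₃:=x-correct _ (_ , refl) (inj₂ (inj₁ r2)) _ (_ , refl) = inj₂ (inj₁ r2)
  r₃:=x-correct _ (v , refl) (inj₂ (inj₂ (eq , _))) (_ , γ') (tr , refl) with v ≟ 1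
  ... | yes refl = inj₂ (inj₂ refl)
  ... | no v≢1   = ⊥-elim (eq v v≢1 γ' (_ , is-rd r₃ , tr))

  r₁:=x-preserves-A1-0 : Hoare 2 (A1-0 ∩ A2-0) r₁:=x A1-0
  r₁:=x-preserves-A1-0 _ (_ , refl) ((d , n , _) , _) (_ , γ') (tr , refl) =
    stable-step (Def-stable h) d tr , stable-step (NotRd-stable (harmless-commutes h)) n tr ,
    λ { refl → n γ' (_ , is-rd r₁ , tr) }
    where h = reads (is-rd r₁)

  A1-0-frame : ∀ {t P com} → (∀ a → com a → Harmless x a) → Untouched r₁ com → Hoare t (A1-0 ∩ P) com A1-0
  A1-0-frame harmless keep a ca {ρ , _} ((d , n , r1) , _) _ (tr , refl) =
    stable-step (Def-stable h) d tr , stable-step (NotRd-stable (harmless-commutes h)) n tr ,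
    λ e → r1 (trans (sym (keep a ca ρ)) e)
    where h = harmless a ca

  y:=ᵂˢ1-preserves-A1-0 : Hoare 2 (A1-0 ∩ A2-1) y:=ᵂˢ1 A1-0
  y:=ᵂˢ1-preserves-A1-0 = A1-0-frame (λ { _ refl → elsewhere refl λ () }) (λ { _ refl _ → refl })

  r₂:=ᴿˢy-preserves-A1-0 : Hoare 3 (A1-0 ∩ A3-0) r₂:=ᴿˢy A1-0
  r₂:=ᴿˢy-preserves-A1-0 = A1-0-frame (λ { _ (_ , refl) → elsewhere refl λ () }) (λ { _ (_ , refl) _ → refl })

  r₃:=x-preserves-A1-0 : Hoare 3 (A1-0 ∩ A3-1) r₃:=x A1-0
  r₃:=x-preserves-A1-0 = A1-0-frame (λ { _ (_ , refl) → reads (is-rd r₃) }) (λ { _ (_ , refl) _ → refl })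

  x:=1-preserves-A2-0 : Hoare 1 (A2-0 ∩ A1-0) x:=1 A2-0
  x:=1-preserves-A2-0 _ refl ((n , r2 , _) , ((_ , up) , n₂ , _)) _ (tw , refl) =
    stable-step (NotRd-stable (harmless-commutes (elsewhere refl λ ()))) n tw , r2 ,
    inj₂ λ { _ (_ , (r , refl) , tr) → read-from-write (λ ()) is-wr (is-rd r) up n₂ tw tr }

  x:=1-preserves-A2-1 : Hoare 1 (A2-1 ∩ A1-0) x:=1 A2-1
  x:=1-preserves-A2-1 _ refl ((n , r2 , _) , (_ , _ , r1)) _ (tw , refl) =
    stable-step (NotRd-stable (harmless-commutes (elsewhere refl λ ()))) n tw , r2 , inj₁ r1

  r₂:=ᴿˢy-preserves-A2-0 : Hoare 3 (A2-0 ∩ A3-0) r₂:=ᴿˢy A2-0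
  r₂:=ᴿˢy-preserves-A2-0 _ (_ , refl) ((n , _ , d) , _) (_ , γ') (tr , refl) =
    stable-step (NotRd-stable (harmless-commutes (reads (is-rdRS r₂)))) n tr ,
    (λ { refl → n γ' (_ , is-rdRS r₂ , tr) }) ,
    stable-step (∪-stable (Def-stable h) (Cond-stable h (Def-stable h))) d tr
    where h = elsewhere refl λ ()

  r₃:=x-preserves-A2-0 : Hoare 3 (A2-0 ∩ A3-1) r₃:=x A2-0
  r₃:=x-preserves-A2-0 _ (_ , refl) ((n , r2 , d) , _) _ (tr , refl) =
    stable-step (NotRd-stable (harmless-commutes (elsewhere refl λ ()))) n tr , r2 ,
    stable-step (∪-stable (Def-stable h) (Cond-stable h (Def-stable h))) d tr
    where h = reads (is-rd r₃)

  r₂:=ᴿˢy-preserves-A2-1 : Hoare 3 (A2-1 ∩ A3-0) r₂:=ᴿˢy A2-1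
  r₂:=ᴿˢy-preserves-A2-1 _ (_ , refl) ((n , _ , d) , _) (_ , γ') (tr , refl) =
    stable-step (NotRd-stable (harmless-commutes (reads (is-rdRS r₂)))) n tr ,
    (λ { refl → n γ' (_ , is-rdRS r₂ , tr) }) ,
    map₂ (λ d₁ → stable-step (Def-stable (elsewhere refl λ ())) d₁ tr) d

  r₃:=x-preserves-A2-1 : Hoare 3 (A2-1 ∩ A3-1) r₃:=x A2-1
  r₃:=x-preserves-A2-1 _ (_ , refl) ((n , r2 , d) , _) _ (tr , refl) =
    stable-step (NotRd-stable (harmless-commutes (elsewhere refl λ ()))) n tr , r2 ,
    map₂ (λ d₁ → stable-step (Def-stable (reads (is-rd r₃))) d₁ tr) d

  -- If r₁ becomes 1, thread 3 still cannot read y = 1, so the second disjunct holds vacuously.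
  r₁:=x-preserves-A3-0 : Hoare 2 (A3-0 ∩ A2-0) r₁:=x A3-0
  r₁:=x-preserves-A3-0 _ (v , refl) (_ , (n , _ , _)) _ (tr , refl) with v ≟ 1
  ... | yes refl = inj₂ (NotRd⇒CondS (stable-step (NotRd-stable (harmless-commutes (elsewhere refl λ ()))) n tr))
  ... | no v≢1   = inj₁ v≢1

  y:=ᵂˢ1-preserves-A3-0 : Hoare 2 (A3-0 ∩ A2-1) y:=ᵂˢ1 A3-0
  y:=ᵂˢ1-preserves-A3-0 _ refl (_ , (_ , _ , inj₁ r1)) _ (_ , refl) = inj₁ r1
  y:=ᵂˢ1-preserves-A3-0 _ refl (_ , (n , _ , inj₂ d)) _ (tw , refl) =
    inj₂ λ { _ (_ , (r , refl) , tr) → message-passing (λ ()) (λ ()) d n tw tr }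

  x:=1-keeps-r₁≢1 : ∀ {P Q R} → Hoare 1 ((RegNe r₁ 1 ∪ P) ∩ (Q ∩ R ∩ RegNe r₁ 1)) x:=1 (RegNe r₁ 1 ∪ P)
  x:=1-keeps-r₁≢1 = register-frame (λ { _ refl _ → refl }) (λ { (_ , _ , r1) → r1 }) inj₁

  r₂≢1-frame : ∀ {P Q R S com} → Untouched r₂ com →
               Hoare 2 ((P ∪ RegNe r₂ 1 ∪ Q) ∩ (R ∩ RegNe r₂ 1 ∩ S)) com (P ∪ RegNe r₂ 1 ∪ Q)
  r₂≢1-frame keep = register-frame keep (λ { (_ , r2 , _) → r2 }) (λ r2 → inj₂ (inj₁ r2))

  r₁:=x-keeps-r₂≢1 : ∀ {P Q R S} → Hoare 2 ((P ∪ RegNe r₂ 1 ∪ Q) ∩ (R ∩ RegNe r₂ 1 ∩ S)) r₁:=x (P ∪ RegNe r₂ 1 ∪ Q)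
  r₁:=x-keeps-r₂≢1 = r₂≢1-frame λ { _ (_ , refl) _ → refl }

  y:=ᵂˢ1-keeps-r₂≢1 : ∀ {P Q R S} → Hoare 2 ((P ∪ RegNe r₂ 1 ∪ Q) ∩ (R ∩ RegNe r₂ 1 ∩ S)) y:=ᵂˢ1 (P ∪ RegNe r₂ 1 ∪ Q)
  y:=ᵂˢ1-keeps-r₂≢1 = r₂≢1-frame λ { _ refl _ → refl }

  valid : ValidWRC
  valid = (λ {s} → initial {s}) , (λ { (_ , _ , p) → p }) , local , global
    where
      initial : WRC-Pre ⊆ (A1-0 ∩ A2-0 ∩ A3-0)
      initial (d₁ , (eq₂ , up₂) , (eq₃ , _) , r1 , r2) =
          (d₁ , eq₂ 1 (λ ()) , λ e → 0≢1+n (trans (sym r1) e))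
        , (eq₃ 1 (λ ()) , (λ e → 0≢1+n (trans (sym r2) e)) , inj₁ (eq₂ , up₂))
        , inj₁ (λ e → 0≢1+n (trans (sym r1) e))

      local : LocallyCorrect WRC-Outline
      local = (hoare-U ∷ []) ∷ (r₁:=x-correct ∷ hoare-U ∷ []) ∷ (r₂:=ᴿˢy-correct ∷ r₃:=x-correct ∷ []) ∷ []

      global : GloballyCorrect WRC-Outline
      global =
          ( (λ 1≢1 → ⊥-elim (1≢1 refl))
          ∷ (λ _ → ((r₁:=x-preserves-A1-0 ∷ y:=ᵂˢ1-preserves-A1-0 ∷ [])
                   ∷ (hoare-U ∷ hoare-U ∷ []) ∷ []) ∷ [])
          ∷ (λ _ → ((r₂:=ᴿˢy-preserves-A1-0 ∷ r₃:=x-preserves-A1-0 ∷ [])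
                   ∷ (hoare-U ∷ hoare-U ∷ []) ∷ []) ∷ [])
          ∷ [])
        ∷ ( (λ _ → ((x:=1-preserves-A2-0 ∷ []) ∷ (x:=1-preserves-A2-1 ∷ []) ∷ [])
                 ∷ ((x:=1-preserves-A2-1 ∷ []) ∷ (hoare-U ∷ []) ∷ []) ∷ [])
          ∷ (λ 2≢2 → ⊥-elim (2≢2 refl))
          ∷ (λ _ → ((r₂:=ᴿˢy-preserves-A2-0 ∷ r₃:=x-preserves-A2-0 ∷ [])
                   ∷ (r₂:=ᴿˢy-preserves-A2-1 ∷ r₃:=x-preserves-A2-1 ∷ []) ∷ [])
                 ∷ ((r₂:=ᴿˢy-preserves-A2-1 ∷ r₃:=x-preserves-A2-1 ∷ []) ∷ (hoare-U ∷ hoare-U ∷ []) ∷ []) ∷ [])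
          ∷ [])
        ∷ ( (λ _ → ((x:=1-keeps-r₁≢1 ∷ []) ∷ (x:=1-keeps-r₁≢1 ∷ []) ∷ [])
                 ∷ ((x:=1-keeps-r₁≢1 ∷ []) ∷ (x:=1-keeps-r₁≢1 ∷ []) ∷ []) ∷ [])
          ∷ (λ _ → ((r₁:=x-preserves-A3-0 ∷ y:=ᵂˢ1-preserves-A3-0 ∷ [])
                   ∷ (r₁:=x-keeps-r₂≢1 ∷ y:=ᵂˢ1-keeps-r₂≢1 ∷ []) ∷ [])
                 ∷ ((r₁:=x-keeps-r₂≢1 ∷ y:=ᵂˢ1-keeps-r₂≢1 ∷ [])
                   ∷ (r₁:=x-keeps-r₂≢1 ∷ y:=ᵂˢ1-keeps-r₂≢1 ∷ []) ∷ []) ∷ [])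
          ∷ (λ 3≢3 → ⊥-elim (3≢3 refl))
          ∷ [])
        ∷ []

lemma5 : (M : MemoryModel) → Model.Axioms M → Model.ValidWRC M
lemma5 M ax = WRC.valid M ax
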